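{- Let $V$ be a finite set, $m\ge1$, $\lambda\in(0,1)$, $\bar\lambda=1-\lambda$, and let $f_1,\dots,f_m:2^V\to\mathbb{R}$ be normalized, monotone non-decreasing, submodular functions. (a) Let $\alpha\le1$ and $\beta\le1$ be the approximation factors of \textsc{AlgWC} for $\max_\pi \min_i f_i(A_i^\pi)$ and \textsc{AlgAC} for $\max_\pi\frac1m\sum_i f_i(A_i^\pi)$, respectively. Then the scheme CombSfaSwp returns a partition $\hat\pi$ with $\bar\lambda\min_i f_i(A_i^{\hat\pi})+\frac{\lambda}{m}\sum_j f_j(A_j^{\hat\pi})\ge \rho\cdot\max_{\pi\in\Pi}\big[\bar\lambda\min_i f_i(A_i^{\pi})+\frac{\lambda}{m}\sum_j f_j(A_j^{\pi})\big]$, where $\rho=\max\{\frac{\beta\alpha}{\bar\lambda\beta+\alpha},\lambda\beta\}$ in general (heterogeneous case) and $\rho=\max\{\min\{\alpha,\frac1m\},\frac{\beta\alpha}{\bar\lambda\beta+\alpha},\lambda\beta\}$ when $f_1=\dots=f_m$ (homogeneous case). (b) Let $\alpha\ge1$ and $\beta\ge1$ be the approximation factors of \textsc{AlgWC} for $\min_\pi\max_i f_i(A_i^\pi)$ and \textsc{AlgAC} for $\min_\pi\frac1m\sum_i f_i(A_i^\pi)$, respectively. Then the scheme CombSlbSmp returns a partition $\hat\pi$ with $\bar\lambda\max_i f_i(A_i^{\hat\pi})+\frac{\lambda}{m}\sum_j f_j(A_j^{\hat\pi})\le \rho'\cdot\min_{\pi\in\Pi}\big[\bar\lambda\max_i f_i(A_i^{\pi})+\frac{\lambda}{m}\sum_j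 f_j(A_j^{\pi})\big]$, where $\rho'=\min\{\frac{m\alpha}{m\bar\lambda+\lambda},\beta(m\bar\lambda+\lambda)\}$ in general (heterogeneous case) and $\rho'=\min\{m,\frac{m\alpha}{m\bar\lambda+\lambda},\beta(m\bar\lambda+\lambda)\}$ when $f_1=\dots=f_m$ (homogeneous case).
   Context: $f$ is normalized if $f(\emptyset)=0$, monotone non-decreasing if $f(S)\le f(T)$ for $S\subseteq T$, submodular if $f(S)+f(T)\ge f(S\cup T)+f(S\cap T)$. $\Pi$ is the set of ordered partitions $\pi=(A_1^\pi,\dots,A_m^\pi)$ of $V$ into $m$ pairwise disjoint (possibly empty) blocks covering $V$. For a maximization problem, an algorithm has approximation factor $\alpha\le1$ if its output value is at least $\alpha$ times the optimum; for a minimization problem, factor $\alpha\ge1$ if its output value is at most $\alpha$ times the optimum. CombSfaSwp: run \textsc{AlgWC} to get $\hat\pi_1$ and \textsc{AlgAC} to get $\hat\pi_2$, and output whichever of $\hat\pi_1,\hat\pi_2$ has the larger value of $\bar\lambda\min_i f_i(A_i^\pi)+\frac{\lambda}{m}\sum_j f_j(A_j^\pi)$. CombSlbSmp: run \textsc{AlgWC} (for the max-block minimization) to get $\hat\pi_1$ and \textsc{AlgAC} (for the average minimization) to get $\hat\pi_2$, and output whichever has the smaller value of $\bar\lambda\max_i f_i(A_i^\pi)+\frac{\lambda}{m}\sum_j f_j(A_j^\pi)$. -}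

module Defs where

open import Data.Bool using (Bool; if_then_else_)
open import Data.Nat using (ℕ) renaming (zero to zeroℕ; suc to sucℕ)
open import Data.Fin using (Fin; zero; suc; _≟_)
open import Data.Fin.Subset using (Subset; _⊆_; _∪_; _∩_; ⊥)
open import Data.Vec using (tabulate)
open import Function using (_∘_)
open import Relation.Nullary using (¬_)
open import Relation.Nullary.Decidable using (does)
open import Relation.Binary.PropositionalEquality using (_≡_)
open import Relation.Binary.Definitions using (Decidable)
open import Relation.Binary.Structures using (IsTotalOrder)
open import Algebra.Structures using (IsCommutativeRing)
open import Data.Product using (_×_)

-- An ordered field (the real numbers are one; the paper's statement only uses
-- ordered-field reasoning, so we state it for every ordered field, which
-- includes ℝ).  The order is total and decidable (classically
-- true for ℝ), so max/min and the selection step of the schemes make sense.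
record OrderedField : Set₁ where
  infixl 6 _+_ _-_
  infixl 7 _*_ _/_
  infix 8 -_
  infix 9 _⁻¹
  infix 4 _≤_ _<_
  field
    Carrier : Set
    _+_ _*_ : Carrier → Carrier → Carrier
    -_ : Carrier → Carrier
    0# 1# : Carrier
    _⁻¹ : Carrier → Carrier
    _≤_ : Carrier → Carrier → Set
    isCommutativeRing : IsCommutativeRing _≡_ _+_ _*_ -_ 0# 1#
    0≢1 : ¬ (0# ≡ 1#)
    ⁻¹-inverse : ∀ x → ¬ (x ≡ 0#) → x * x ⁻¹ ≡ 1#
    isTotalOrder : IsTotalOrder _≡_ _≤_
    _≤?_ : Decidable _≤_
    +-mono-≤ : ∀ {x y} z → x ≤ y → x + z ≤ y + z
    *-nonneg : ∀ {x y} → 0# ≤ x → 0# ≤ y → 0# ≤ x * y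

  _-_ : Carrier → Carrier → Carrier
  x - y = x + (- y)

  _/_ : Carrier → Carrier → Carrier
  x / y = x * y ⁻¹

  _<_ : Carrier → Carrier → Set
  x < y = (x ≤ y) × ¬ (x ≡ y)

  max : Carrier → Carrier → Carrier
  max x y = if does (x ≤? y) then y else x

  min : Carrier → Carrier → Carrier
  min x y = if does (x ≤? y) then x else y

  fromℕ : ℕ → Carrier
  fromℕ zeroℕ = 0#
  fromℕ (sucℕ n) = 1# + fromℕ n

module Notions (F : OrderedField) where
  open OrderedField F

  -- Ground set V = Fin n; subsets of V are Data.Fin.Subset.
  Normalized : ∀ {n} → (Subset n → Carrier) → Set
  Normalized f = f ⊥ ≡ 0#

  MonotoneNonDecreasing : ∀ {n} → (Subset n → Carrier) → Set
  MonotoneNonDecreasing {n} f = ∀ (S T : Subset n) → S ⊆ T → f S ≤ f T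

  Submodular : ∀ {n} → (Subset n → Carrier) → Set
  Submodular {n} f = ∀ (S T : Subset n) → f (S ∪ T) + f (S ∩ T) ≤ f S + f T

  -- An ordered partition (A_1,…,A_m) of V into m pairwise disjoint, possibly
  -- empty, blocks covering V is exactly an assignment V → Fin m; block i is
  -- the preimage of i.
  Partition : ℕ → ℕ → Set
  Partition n m = Fin n → Fin m

  block : ∀ {n m} → Partition n m → Fin m → Subset n
  block π i = tabulate (λ v → does (π v ≟ i))

  minOver : ∀ {k} → (Fin (sucℕ k) → Carrier) → Carrier
  minOver {zeroℕ} g = g zero
  minOver {sucℕ k} g = min (g zero) (minOver (g ∘ suc))

  maxOver : ∀ {k} → (Fin (sucℕ k) → Carrier) → Carrier
  maxOver {zeroℕ} g = g zero
  maxOver {sucℕ k} g = max (g zero) (maxOver (g ∘ suc))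

  sumOver : ∀ {k} → (Fin k → Carrier) → Carrier
  sumOver {zeroℕ} g = 0#
  sumOver {sucℕ k} g = g zero + sumOver (g ∘ suc)

  module _ {n k : ℕ} (f : Fin (sucℕ k) → Subset n → Carrier) where
    -- number of blocks m = suc k ≥ 1
    m# : Carrier
    m# = fromℕ (sucℕ k)

    minVal : Partition n (sucℕ k) → Carrier
    minVal π = minOver (λ i → f i (block π i))

    maxVal : Partition n (sucℕ k) → Carrier
    maxVal π = maxOver (λ i → f i (block π i))

    avgVal : Partition n (sucℕ k) → Carrier
    avgVal π = sumOver (λ i → f i (block π i)) / m#

    objMax : Carrier → Partition n (sucℕ k) → Carrier
    objMax lam π = (1# - lam) * minVal π + (lam / m#) * sumOver (λ j → f j (block π j))

    objMin : Carrier → Partition n (sucℕ k) → Carrier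
    objMin lam π = (1# - lam) * maxVal π + (lam / m#) * sumOver (λ j → f j (block π j))

    combSfaSwp : Carrier → Partition n (sucℕ k) → Partition n (sucℕ k) → Partition n (sucℕ k)
    combSfaSwp lam π₁ π₂ = if does (objMax lam π₂ ≤? objMax lam π₁) then π₁ else π₂

    combSlbSmp : Carrier → Partition n (sucℕ k) → Partition n (sucℕ k) → Partition n (sucℕ k)
    combSlbSmp lam π₁ π₂ = if does (objMin lam π₁ ≤? objMin lam π₂) then π₁ else π₂

module Submission where

-- For nonnegative block values
-- min ≤ avg ≤ max ≤ m·avg, so min ≤ objMax ≤ avg, avg ≤ objMin ≤ max and
-- max·(mλ̄ + λ)/m ≤ objMin ≤ avg·(mλ̄ + λ).  Hence each single-criterion guarantee transfers
-- to the combined objective, and the scheme keeps the better of the two candidates.  For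
-- maximisation the two guarantees can also be mixed with weights λ̄β/D and α/D, D = λ̄β + α,
-- which gives the factor βα/D.  In the homogeneous case f(V) bounds every block from above
-- (monotonicity) and the sum of all blocks from below (subadditivity), giving 1/m and m.

open import Algebra.Bundles using (CommutativeRing)
open import Algebra.Construct.NaturalChoice.Base using (MinOperator; MaxOperator)
import Algebra.Construct.NaturalChoice.MaxOp as MaxOp
import Algebra.Construct.NaturalChoice.MinOp as MinOp
open import Data.Bool.Properties using (if-float)
open import Data.Empty using (⊥-elim)
open import Data.Fin using (Fin; zero; suc; _≟_)
open import Data.Fin.Subset using (Subset; _⊆_; _∪_; _∩_; _∈_; ⊥; ⊤; ⋃)
open import Data.Fin.Subset.Properties using (⊥⊆; ⊆⊤; p⊆p∪q; q⊆p∪q)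
import Data.List as List
open import Data.Nat using (ℕ; zero; suc)
open import Data.Product using (_×_; _,_; proj₁)
open import Data.Sum using (inj₁; inj₂)
open import Data.Vec using (tabulate)
open import Data.Vec.Properties using (lookup⇒[]=; lookup∘tabulate)
open import Function using (_∘_)
open import Relation.Binary.Bundles using (TotalOrder)
open import Relation.Binary.PropositionalEquality using (_≡_; refl; sym; trans; cong; cong₂; subst; subst₂)
open import Relation.Nullary using (¬_; yes; no; contradiction)
open import Relation.Nullary.Decidable using (does; dec-true)

open import Defs

module OrderedFieldProperties (F : OrderedField) where
  open OrderedField F public renaming (+-mono-≤ to +-monoˡ-≤)

  commutativeRing : CommutativeRing _ _
  commutativeRing = record { isCommutativeRing = isCommutativeRing }

  open CommutativeRing commutativeRing
    using (+-comm; +-assoc; *-comm; +-identityˡ; +-identityʳ; *-identityˡ; *-identityʳ; distribʳ; -‿inverseˡ; -‿inverseʳ; distribˡ; zeroʳ; ring)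
  open import Algebra.Properties.Ring ring using (-‿distribʳ-*; -1*x≈-x; -‿involutive)

  totalOrder : TotalOrder _ _ _
  totalOrder = record { isTotalOrder = isTotalOrder }

  open TotalOrder totalOrder public using (total; antisym; poset; totalPreorder)
    renaming (refl to ≤-refl; trans to ≤-trans; ≤-respˡ-≈ to ≤-respˡ-≡; ≤-respʳ-≈ to ≤-respʳ-≡)

  module ≤-Reasoning where
    open import Relation.Binary.Reasoning.PartialOrder poset public

  min-of-≤ : ∀ {x y} → x ≤ y → min x y ≡ x
  min-of-≤ {x} {y} x≤y with x ≤? y
  ... | yes _ = refl
  ... | no x≰y = contradiction x≤y x≰y

  min-of-≥ : ∀ {x y} → y ≤ x → min x y ≡ y
  min-of-≥ {x} {y} y≤x with x ≤? y
  ... | yes x≤y = antisym x≤y y≤x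
  ... | no _ = refl

  max-of-≤ : ∀ {x y} → x ≤ y → max x y ≡ y
  max-of-≤ {x} {y} x≤y with x ≤? y
  ... | yes _ = refl
  ... | no x≰y = contradiction x≤y x≰y

  max-of-≥ : ∀ {x y} → y ≤ x → max x y ≡ x
  max-of-≥ {x} {y} y≤x with x ≤? y
  ... | yes x≤y = antisym y≤x x≤y
  ... | no _ = refl

  minOperator : MinOperator totalPreorder
  minOperator = record { _⊓_ = min ; x≤y⇒x⊓y≈x = min-of-≤ ; x≥y⇒x⊓y≈y = min-of-≥ }

  maxOperator : MaxOperator totalPreorder
  maxOperator = record { _⊔_ = max ; x≤y⇒x⊔y≈y = max-of-≤ ; x≥y⇒x⊔y≈x = max-of-≥ }

  open MinOp minOperator public using (x⊓y≤x; x⊓y≤y; ⊓-glb; ⊓-sel)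
  open MaxOp maxOperator public using (x≤x⊔y; x≤y⊔x; ⊔-lub; ⊔-sel)

  max-preserves : (P : Carrier → Set) → ∀ {x y} → P x → P y → P (max x y)
  max-preserves P {x} {y} px py with ⊔-sel x y
  ... | inj₁ x⊔y≡x = subst P (sym x⊔y≡x) px
  ... | inj₂ x⊔y≡y = subst P (sym x⊔y≡y) py

  min-preserves : (P : Carrier → Set) → ∀ {x y} → P x → P y → P (min x y)
  min-preserves P {x} {y} px py with ⊓-sel x y
  ... | inj₁ x⊓y≡x = subst P (sym x⊓y≡x) px
  ... | inj₂ x⊓y≡y = subst P (sym x⊓y≡y) py

  +-monoʳ-≤ : ∀ {x y} z → x ≤ y → z + x ≤ z + y
  +-monoʳ-≤ {x} {y} z x≤y = subst₂ _≤_ (+-comm x z) (+-comm y z) (+-monoˡ-≤ z x≤y)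

  +-mono-≤ : ∀ {x y u v} → x ≤ y → u ≤ v → x + u ≤ y + v
  +-mono-≤ {y = y} {u} x≤y u≤v = ≤-trans (+-monoˡ-≤ u x≤y) (+-monoʳ-≤ y u≤v)

  x≤x+y : ∀ {x y} → 0# ≤ y → x ≤ x + y
  x≤x+y {x} {y} 0≤y = subst (_≤ x + y) (+-identityʳ x) (+-monoʳ-≤ x 0≤y)

  x≤y+x : ∀ {x y} → 0# ≤ y → x ≤ y + x
  x≤y+x {x} {y} 0≤y = subst (x ≤_) (+-comm x y) (x≤x+y 0≤y)

  +-nonneg : ∀ {x y} → 0# ≤ x → 0# ≤ y → 0# ≤ x + y
  +-nonneg 0≤x 0≤y = ≤-trans 0≤y (x≤y+x 0≤x)

  x≤y⇒0≤y-x : ∀ {x y} → x ≤ y → 0# ≤ y - x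
  x≤y⇒0≤y-x {x} x≤y = subst (_≤ _) (-‿inverseʳ x) (+-monoˡ-≤ (- x) x≤y)

  y-x+x≡y : ∀ x y → y - x + x ≡ y
  y-x+x≡y x y = trans (+-assoc y (- x) x) (trans (cong (y +_) (-‿inverseˡ x)) (+-identityʳ y))

  0≤y-x⇒x≤y : ∀ {x y} → 0# ≤ y - x → x ≤ y
  0≤y-x⇒x≤y {x} {y} 0≤y-x = subst₂ _≤_ (+-identityˡ x) (y-x+x≡y x y) (+-monoˡ-≤ x 0≤y-x)

  *-monoʳ-≤-nonneg : ∀ {x y z} → 0# ≤ z → x ≤ y → z * x ≤ z * y
  *-monoʳ-≤-nonneg {x} {y} {z} 0≤z x≤y =
    0≤y-x⇒x≤y (subst (0# ≤_) z*[y-x]≡z*y-z*x (*-nonneg 0≤z (x≤y⇒0≤y-x x≤y)))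
    where
    z*[y-x]≡z*y-z*x : z * (y - x) ≡ z * y - z * x
    z*[y-x]≡z*y-z*x = trans (distribˡ z y (- x)) (cong (z * y +_) (sym (-‿distribʳ-* z x)))

  *-monoˡ-≤-nonneg : ∀ {x y z} → 0# ≤ z → x ≤ y → x * z ≤ y * z
  *-monoˡ-≤-nonneg {x} {y} {z} 0≤z x≤y = subst₂ _≤_ (*-comm z x) (*-comm z y) (*-monoʳ-≤-nonneg 0≤z x≤y)

  0≤1 : 0# ≤ 1#
  0≤1 with total 0# 1#
  ... | inj₁ 0≤1 = 0≤1
  ... | inj₂ 1≤0 = subst (0# ≤_) [-1]*[-1]≡1 (*-nonneg 0≤-1 0≤-1)
    where
    0≤-1 : 0# ≤ - 1#
    0≤-1 = subst₂ _≤_ (-‿inverseʳ 1#) (+-identityˡ (- 1#)) (+-monoˡ-≤ (- 1#) 1≤0)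
    [-1]*[-1]≡1 : - 1# * - 1# ≡ 1#
    [-1]*[-1]≡1 = trans (-1*x≈-x (- 1#)) (-‿involutive 1#)

  0<1 : 0# < 1#
  0<1 = 0≤1 , 0≢1

  0<x≤y⇒y≢0 : ∀ {x y} → 0# < x → x ≤ y → ¬ y ≡ 0#
  0<x≤y⇒y≢0 (0≤x , 0≢x) x≤y refl = 0≢x (antisym 0≤x x≤y)

  ⁻¹-nonneg : ∀ {x} → 0# ≤ x → ¬ x ≡ 0# → 0# ≤ x ⁻¹
  ⁻¹-nonneg {x} 0≤x x≢0 with total 0# (x ⁻¹)
  ... | inj₁ 0≤x⁻¹ = 0≤x⁻¹
  ... | inj₂ x⁻¹≤0 = ⊥-elim (0≢1 (antisym 0≤1 (subst₂ _≤_ (⁻¹-inverse x x≢0) (zeroʳ x) (*-monoʳ-≤-nonneg 0≤x x⁻¹≤0))))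

  fromℕ-nonneg : ∀ k → 0# ≤ fromℕ k
  fromℕ-nonneg zero = ≤-refl
  fromℕ-nonneg (suc k) = +-nonneg 0≤1 (fromℕ-nonneg k)

  1≤fromℕ-suc : ∀ k → 1# ≤ fromℕ (suc k)
  1≤fromℕ-suc k = x≤x+y (fromℕ-nonneg k)

  convex-idem : ∀ {s t} → s + t ≡ 1# → ∀ z → s * z + t * z ≡ z
  convex-idem {s} {t} s+t≡1 z = trans (sym (distribʳ z s t)) (trans (cong (_* z) s+t≡1) (*-identityˡ z))

  convex-≤ : ∀ {s t x y z} → s + t ≡ 1# → 0# ≤ s → 0# ≤ t → x ≤ z → y ≤ z → s * x + t * y ≤ z
  convex-≤ {s} {t} {x} {y} {z} s+t≡1 0≤s 0≤t x≤z y≤z =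
    subst (s * x + t * y ≤_) (convex-idem s+t≡1 z) (+-mono-≤ (*-monoʳ-≤-nonneg 0≤s x≤z) (*-monoʳ-≤-nonneg 0≤t y≤z))

  convex-≥ : ∀ {s t x y z} → s + t ≡ 1# → 0# ≤ s → 0# ≤ t → z ≤ x → z ≤ y → z ≤ s * x + t * y
  convex-≥ {s} {t} {x} {y} {z} s+t≡1 0≤s 0≤t z≤x z≤y =
    subst (_≤ s * x + t * y) (convex-idem s+t≡1 z) (+-mono-≤ (*-monoʳ-≤-nonneg 0≤s z≤x) (*-monoʳ-≤-nonneg 0≤t z≤y))

module AggregateProperties (F : OrderedField) where
  open OrderedFieldProperties F
  open Notions F
  open CommutativeRing commutativeRing using (distribˡ; *-identityʳ; zeroˡ; zeroʳ)

  minOver-≤ : ∀ {k} (g : Fin (suc k) → Carrier) i → minOver g ≤ g i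
  minOver-≤ {zero} g zero = ≤-refl
  minOver-≤ {suc k} g zero = x⊓y≤x (g zero) (minOver (g ∘ suc))
  minOver-≤ {suc k} g (suc i) = ≤-trans (x⊓y≤y (g zero) (minOver (g ∘ suc))) (minOver-≤ (g ∘ suc) i)

  minOver-glb : ∀ {k} {g : Fin (suc k) → Carrier} {c} → (∀ i → c ≤ g i) → c ≤ minOver g
  minOver-glb {zero} c≤g = c≤g zero
  minOver-glb {suc k} c≤g = ⊓-glb (c≤g zero) (minOver-glb (c≤g ∘ suc))

  ≤-maxOver : ∀ {k} (g : Fin (suc k) → Carrier) i → g i ≤ maxOver g
  ≤-maxOver {zero} g zero = ≤-refl
  ≤-maxOver {suc k} g zero = x≤x⊔y (g zero) (maxOver (g ∘ suc))
  ≤-maxOver {suc k} g (suc i) = ≤-trans (≤-maxOver (g ∘ suc) i) (x≤y⊔x (g zero) (maxOver (g ∘ suc)))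

  maxOver-lub : ∀ {k} {g : Fin (suc k) → Carrier} {c} → (∀ i → g i ≤ c) → maxOver g ≤ c
  maxOver-lub {zero} g≤c = g≤c zero
  maxOver-lub {suc k} g≤c = ⊔-lub (g≤c zero) (maxOver-lub (g≤c ∘ suc))

  c*suc≡c+c*k : ∀ c k → c * fromℕ (suc k) ≡ c + c * fromℕ k
  c*suc≡c+c*k c k = trans (distribˡ c 1# (fromℕ k)) (cong (_+ c * fromℕ k) (*-identityʳ c))

  sumOver-≥ : ∀ {k} {g : Fin k → Carrier} {c} → (∀ i → c ≤ g i) → c * fromℕ k ≤ sumOver g
  sumOver-≥ {zero} {c = c} _ = ≤-respˡ-≡ (sym (zeroʳ c)) ≤-refl
  sumOver-≥ {suc k} {c = c} c≤g =
    ≤-respˡ-≡ (sym (c*suc≡c+c*k c k)) (+-mono-≤ (c≤g zero) (sumOver-≥ (c≤g ∘ suc)))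

  sumOver-≤ : ∀ {k} {g : Fin k → Carrier} {c} → (∀ i → g i ≤ c) → sumOver g ≤ c * fromℕ k
  sumOver-≤ {zero} {c = c} _ = ≤-respʳ-≡ (sym (zeroʳ c)) ≤-refl
  sumOver-≤ {suc k} {c = c} g≤c =
    ≤-respʳ-≡ (sym (c*suc≡c+c*k c k)) (+-mono-≤ (g≤c zero) (sumOver-≤ (g≤c ∘ suc)))

  sumOver-nonneg : ∀ {k} {g : Fin k → Carrier} → (∀ i → 0# ≤ g i) → 0# ≤ sumOver g
  sumOver-nonneg {k} 0≤g = ≤-respˡ-≡ (zeroˡ (fromℕ k)) (sumOver-≥ 0≤g)

  ≤-sumOver : ∀ {k} {g : Fin k → Carrier} → (∀ i → 0# ≤ g i) → ∀ i → g i ≤ sumOver g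
  ≤-sumOver 0≤g zero = x≤x+y (sumOver-nonneg (0≤g ∘ suc))
  ≤-sumOver 0≤g (suc i) = ≤-trans (≤-sumOver (0≤g ∘ suc) i) (x≤y+x (0≤g zero))

  sumOver-cong : ∀ {k} {g h : Fin k → Carrier} → (∀ i → g i ≡ h i) → sumOver g ≡ sumOver h
  sumOver-cong {zero} _ = refl
  sumOver-cong {suc k} g≡h = cong₂ _+_ (g≡h zero) (sumOver-cong (g≡h ∘ suc))

∈-⋃-tabulate : ∀ {n k} (B : Fin k → Subset n) i {x} → x ∈ B i → x ∈ ⋃ (List.tabulate B)
∈-⋃-tabulate B zero x∈Bi = p⊆p∪q (⋃ (List.tabulate (B ∘ suc))) x∈Bi
∈-⋃-tabulate B (suc i) x∈Bi = q⊆p∪q (B zero) _ (∈-⋃-tabulate (B ∘ suc) i x∈Bi)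

module SubmodularProperties (F : OrderedField) where
  open OrderedFieldProperties F
  open AggregateProperties F
  open Notions F

  ∈-block : ∀ {n m} (π : Partition n m) x → x ∈ block π (π x)
  ∈-block π x = lookup⇒[]= x (tabulate (λ v → does (π v ≟ π x)))
    (trans (lookup∘tabulate (λ v → does (π v ≟ π x)) x) (dec-true (π x ≟ π x) refl))

  ⊤⊆⋃-blocks : ∀ {n m} (π : Partition n m) → ⊤ ⊆ ⋃ (List.tabulate (block π))
  ⊤⊆⋃-blocks π {x} _ = ∈-⋃-tabulate (block π) (π x) (∈-block π x)

  module _ {n} {f : Subset n → Carrier} (f-normalized : Normalized f)
           (f-mono : MonotoneNonDecreasing f) (f-submodular : Submodular f) where

    nonneg : ∀ S → 0# ≤ f S
    nonneg S = ≤-respˡ-≡ f-normalized (f-mono ⊥ S ⊥⊆)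

    subadditive : ∀ S T → f (S ∪ T) ≤ f S + f T
    subadditive S T = ≤-trans (x≤x+y (nonneg (S ∩ T))) (f-submodular S T)

    ⋃-subadditive : ∀ {k} (B : Fin k → Subset n) → f (⋃ (List.tabulate B)) ≤ sumOver (f ∘ B)
    ⋃-subadditive {zero} B = ≤-respˡ-≡ (sym f-normalized) ≤-refl
    ⋃-subadditive {suc k} B = ≤-trans (subadditive (B zero) _) (+-monoʳ-≤ (f (B zero)) (⋃-subadditive (B ∘ suc)))

    ⊤-≤-sumOver-blocks : ∀ {m} (π : Partition n m) → f ⊤ ≤ sumOver (λ i → f (block π i))
    ⊤-≤-sumOver-blocks π = ≤-trans (f-mono ⊤ _ (⊤⊆⋃-blocks π)) (⋃-subadditive (block π))

module Objectives (F : OrderedField) where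
  open OrderedFieldProperties F
  open AggregateProperties F
  open SubmodularProperties F using (⊤-≤-sumOver-blocks)
  open Notions F
  open CommutativeRing commutativeRing
    using (*-assoc; *-comm; *-identityˡ; *-identityʳ; distribʳ; commutativeSemiring)
  open import Algebra.Solver.Ring.NaturalCoefficients.Default commutativeSemiring
    using (solve; _:+_; _:*_; _:=_)

  module Bounds {n k} (f : Fin (suc k) → Subset n → Carrier) (f-nonneg : ∀ i S → 0# ≤ f i S)
           {lam} (0≤lam : 0# ≤ lam) (lam≤1 : lam ≤ 1#) where

    m μ lamᶜ E : Carrier
    m = m# f
    μ = m ⁻¹
    lamᶜ = 1# - lam
    E = m * lamᶜ + lam

    value : Partition n (suc k) → Fin (suc k) → Carrier
    value π i = f i (block π i)

    sumVal : Partition n (suc k) → Carrier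
    sumVal π = sumOver (value π)

    m-nonneg : 0# ≤ m
    m-nonneg = fromℕ-nonneg (suc k)

    1≤m : 1# ≤ m
    1≤m = 1≤fromℕ-suc k

    m≢0 : ¬ m ≡ 0#
    m≢0 = 0<x≤y⇒y≢0 0<1 1≤m

    m*μ≡1 : m * μ ≡ 1#
    m*μ≡1 = ⁻¹-inverse m m≢0

    μ-nonneg : 0# ≤ μ
    μ-nonneg = ⁻¹-nonneg m-nonneg m≢0

    lamᶜ-nonneg : 0# ≤ lamᶜ
    lamᶜ-nonneg = x≤y⇒0≤y-x lam≤1

    lamᶜ+lam≡1 : lamᶜ + lam ≡ 1#
    lamᶜ+lam≡1 = y-x+x≡y lam 1#

    1≤E : 1# ≤ E
    1≤E = ≤-respˡ-≡ lamᶜ+lam≡1 (+-monoˡ-≤ lam (≤-respˡ-≡ (*-identityˡ lamᶜ) (*-monoˡ-≤-nonneg lamᶜ-nonneg 1≤m)))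

    E-nonneg : 0# ≤ E
    E-nonneg = ≤-trans 0≤1 1≤E

    E*E⁻¹≡1 : E * E ⁻¹ ≡ 1#
    E*E⁻¹≡1 = ⁻¹-inverse E (0<x≤y⇒y≢0 0<1 1≤E)

    x*m*μ≡x : ∀ x → x * m * μ ≡ x
    x*m*μ≡x x = trans (*-assoc x m μ) (trans (cong (x *_) m*μ≡1) (*-identityʳ x))

    ≤-*μ : ∀ {x y} → x * m ≤ y → x ≤ y * μ
    ≤-*μ {x} x*m≤y = ≤-respˡ-≡ (x*m*μ≡x x) (*-monoˡ-≤-nonneg μ-nonneg x*m≤y)

    *μ-≤ : ∀ {x y} → y ≤ x * m → y * μ ≤ x
    *μ-≤ {x} y≤x*m = ≤-respʳ-≡ (x*m*μ≡x x) (*-monoˡ-≤-nonneg μ-nonneg y≤x*m)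

    sumVal≡avgVal*m : ∀ π → sumVal π ≡ avgVal f π * m
    sumVal≡avgVal*m π = sym (trans (*-assoc (sumVal π) μ m) (trans (cong (sumVal π *_) μ*m≡1) (*-identityʳ (sumVal π))))
      where
      μ*m≡1 : μ * m ≡ 1#
      μ*m≡1 = trans (*-comm μ m) m*μ≡1

    minVal-nonneg : ∀ π → 0# ≤ minVal f π
    minVal-nonneg π = minOver-glb (λ i → f-nonneg i (block π i))

    minVal≤avgVal : ∀ π → minVal f π ≤ avgVal f π
    minVal≤avgVal π = ≤-*μ (sumOver-≥ (minOver-≤ (value π)))

    avgVal≤maxVal : ∀ π → avgVal f π ≤ maxVal f π
    avgVal≤maxVal π = *μ-≤ (sumOver-≤ (≤-maxOver (value π)))

    maxVal≤sumVal : ∀ π → maxVal f π ≤ sumVal π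
    maxVal≤sumVal π = maxOver-lub (≤-sumOver (λ i → f-nonneg i (block π i)))

    lam/m*x≡lam*[x*μ] : ∀ x → (lam / m) * x ≡ lam * (x * μ)
    lam/m*x≡lam*[x*μ] x = trans (*-assoc lam μ x) (cong (lam *_) (*-comm μ x))

    objMax≡ : ∀ π → objMax f lam π ≡ lamᶜ * minVal f π + lam * avgVal f π
    objMax≡ π = cong (lamᶜ * minVal f π +_) (lam/m*x≡lam*[x*μ] (sumVal π))

    objMin≡ : ∀ π → objMin f lam π ≡ lamᶜ * maxVal f π + lam * avgVal f π
    objMin≡ π = cong (lamᶜ * maxVal f π +_) (lam/m*x≡lam*[x*μ] (sumVal π))

    minVal≤objMax : ∀ π → minVal f π ≤ objMax f lam π
    minVal≤objMax π = ≤-respʳ-≡ (sym (objMax≡ π)) (convex-≥ lamᶜ+lam≡1 lamᶜ-nonneg 0≤lam ≤-refl (minVal≤avgVal π))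

    lam*avgVal≤objMax : ∀ π → lam * avgVal f π ≤ objMax f lam π
    lam*avgVal≤objMax π = ≤-respʳ-≡ (sym (objMax≡ π)) (x≤y+x (*-nonneg lamᶜ-nonneg (minVal-nonneg π)))

    objMax≤avgVal : ∀ π → objMax f lam π ≤ avgVal f π
    objMax≤avgVal π = ≤-respˡ-≡ (sym (objMax≡ π)) (convex-≤ lamᶜ+lam≡1 lamᶜ-nonneg 0≤lam (minVal≤avgVal π) ≤-refl)

    objMin≤maxVal : ∀ π → objMin f lam π ≤ maxVal f π
    objMin≤maxVal π = ≤-respˡ-≡ (sym (objMin≡ π)) (convex-≤ lamᶜ+lam≡1 lamᶜ-nonneg 0≤lam ≤-refl (avgVal≤maxVal π))

    avgVal≤objMin : ∀ π → avgVal f π ≤ objMin f lam π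
    avgVal≤objMin π = ≤-respʳ-≡ (sym (objMin≡ π)) (convex-≥ lamᶜ+lam≡1 lamᶜ-nonneg 0≤lam (avgVal≤maxVal π) ≤-refl)

    maxVal≤[m/E]*objMin : ∀ π → maxVal f π ≤ (m / E) * objMin f lam π
    maxVal≤[m/E]*objMin π = begin
      Mx                                          ≡⟨ sym (*-identityʳ Mx) ⟩
      Mx * 1#                                     ≡⟨ cong (Mx *_) (sym E*E⁻¹≡1) ⟩
      Mx * (E * E ⁻¹)                             ≡⟨ cong (λ z → Mx * ((m * lamᶜ + z) * E ⁻¹)) (sym (x*m*μ≡x lam)) ⟩
      Mx * ((m * lamᶜ + lam * m * μ) * E ⁻¹)      ≡⟨ solve 6 (λ x m c l u e → x :* ((m :* c :+ l :* m :* u) :* e) := (m :* e) :* (c :* x :+ l :* (x :* u))) refl Mx m lamᶜ lam μ (E ⁻¹) ⟩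
      (m / E) * (lamᶜ * Mx + lam * (Mx * μ)) ≤⟨ *-monoʳ-≤-nonneg m/E-nonneg (+-monoʳ-≤ (lamᶜ * Mx) (*-monoʳ-≤-nonneg 0≤lam Mx*μ≤avgVal)) ⟩
      (m / E) * (lamᶜ * Mx + lam * avgVal f π) ≡⟨ cong ((m / E) *_) (sym (objMin≡ π)) ⟩
      (m / E) * objMin f lam π              ∎
      where
      open ≤-Reasoning
      Mx = maxVal f π
      m/E-nonneg : 0# ≤ m / E
      m/E-nonneg = *-nonneg m-nonneg (⁻¹-nonneg E-nonneg (0<x≤y⇒y≢0 0<1 1≤E))
      Mx*μ≤avgVal : Mx * μ ≤ avgVal f π
      Mx*μ≤avgVal = *-monoˡ-≤-nonneg μ-nonneg (maxVal≤sumVal π)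

    objMin≤avgVal*E : ∀ π → objMin f lam π ≤ avgVal f π * E
    objMin≤avgVal*E π = begin
      objMin f lam π                         ≡⟨ objMin≡ π ⟩
      lamᶜ * maxVal f π + lam * avg          ≤⟨ +-monoˡ-≤ (lam * avg) (*-monoʳ-≤-nonneg lamᶜ-nonneg (≤-respʳ-≡ (sumVal≡avgVal*m π) (maxVal≤sumVal π))) ⟩
      lamᶜ * (avg * m) + lam * avg           ≡⟨ solve 4 (λ c a m l → c :* (a :* m) :+ l :* a := a :* (m :* c :+ l)) refl lamᶜ avg m lam ⟩
      avg * E                                ∎
      where
      open ≤-Reasoning
      avg = avgVal f π

    combSfaSwp-objMax : ∀ π₁ π₂ → objMax f lam (combSfaSwp f lam π₁ π₂) ≡ max (objMax f lam π₂) (objMax f lam π₁)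
    combSfaSwp-objMax π₁ π₂ = if-float (objMax f lam) (does (objMax f lam π₂ ≤? objMax f lam π₁))

    combSlbSmp-objMin : ∀ π₁ π₂ → objMin f lam (combSlbSmp f lam π₁ π₂) ≡ min (objMin f lam π₁) (objMin f lam π₂)
    combSlbSmp-objMin π₁ π₂ = if-float (objMin f lam) (does (objMin f lam π₁ ≤? objMin f lam π₂))

    module _ {α β} (0<α : 0# < α) (0≤β : 0# ≤ β) (π₁ π₂ π : Partition n (suc k))
             (α-approx : α * minVal f π ≤ minVal f π₁) (β-approx : β * avgVal f π ≤ avgVal f π₂) where

      best : Carrier
      best = max (objMax f lam π₂) (objMax f lam π₁)

      α*minVal≤best : α * minVal f π ≤ best
      α*minVal≤best = ≤-trans α-approx (≤-trans (minVal≤objMax π₁) (x≤y⊔x _ _))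

      lam*β*avgVal≤best : lam * (β * avgVal f π) ≤ best
      lam*β*avgVal≤best = ≤-trans (*-monoʳ-≤-nonneg 0≤lam β-approx) (≤-trans (lam*avgVal≤objMax π₂) (x≤x⊔y _ _))

      lam*β-approx : (lam * β) * objMax f lam π ≤ best
      lam*β-approx = begin
        (lam * β) * objMax f lam π   ≡⟨ *-assoc lam β _ ⟩
        lam * (β * objMax f lam π)   ≤⟨ *-monoʳ-≤-nonneg 0≤lam (*-monoʳ-≤-nonneg 0≤β (objMax≤avgVal π)) ⟩
        lam * (β * avgVal f π)       ≤⟨ lam*β*avgVal≤best ⟩
        best                         ∎
        where open ≤-Reasoning

      βα/D-approx : ((β * α) / (lamᶜ * β + α)) * objMax f lam π ≤ best
      βα/D-approx = begin
        ((β * α) / D) * objMax f lam π                       ≡⟨ cong (((β * α) / D) *_) (objMax≡ π) ⟩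
        ((β * α) / D) * (lamᶜ * minVal f π + lam * avgVal f π) ≡⟨ solve 7 (λ b a e c x l y → ((b :* a) :* e) :* (c :* x :+ l :* y) := ((c :* b) :* e) :* (a :* x) :+ (a :* e) :* (l :* (b :* y))) refl β α (D ⁻¹) lamᶜ (minVal f π) lam (avgVal f π) ⟩
        s * (α * minVal f π) + t * (lam * (β * avgVal f π))   ≤⟨ convex-≤ s+t≡1 s-nonneg t-nonneg α*minVal≤best lam*β*avgVal≤best ⟩
        best                                                 ∎
        where
        open ≤-Reasoning
        D s t : Carrier
        D = lamᶜ * β + α
        s = (lamᶜ * β) / D
        t = α / D
        α≤D : α ≤ D
        α≤D = x≤y+x (*-nonneg lamᶜ-nonneg 0≤β)
        D⁻¹-nonneg : 0# ≤ D ⁻¹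
        D⁻¹-nonneg = ⁻¹-nonneg (≤-trans (proj₁ 0<α) α≤D) (0<x≤y⇒y≢0 0<α α≤D)
        s-nonneg : 0# ≤ s
        s-nonneg = *-nonneg (*-nonneg lamᶜ-nonneg 0≤β) D⁻¹-nonneg
        t-nonneg : 0# ≤ t
        t-nonneg = *-nonneg (proj₁ 0<α) D⁻¹-nonneg
        s+t≡1 : s + t ≡ 1#
        s+t≡1 = trans (sym (distribʳ (D ⁻¹) (lamᶜ * β) α)) (⁻¹-inverse D (0<x≤y⇒y≢0 0<α α≤D))

      combSfaSwp-approx : max ((β * α) / (lamᶜ * β + α)) (lam * β) * objMax f lam π ≤ objMax f lam (combSfaSwp f lam π₁ π₂)
      combSfaSwp-approx = ≤-respʳ-≡ (sym (combSfaSwp-objMax π₁ π₂))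
        (max-preserves (λ ρ → ρ * objMax f lam π ≤ best) βα/D-approx lam*β-approx)

    module _ {α β} (0≤α : 0# ≤ α) (0≤β : 0# ≤ β) (π₁ π₂ π : Partition n (suc k))
             (α-approx : maxVal f π₁ ≤ α * maxVal f π) (β-approx : avgVal f π₂ ≤ β * avgVal f π) where

      worst : Carrier
      worst = min (objMin f lam π₁) (objMin f lam π₂)

      mα/E-approx : worst ≤ ((m * α) / E) * objMin f lam π
      mα/E-approx = begin
        worst                                ≤⟨ x⊓y≤x _ _ ⟩
        objMin f lam π₁                      ≤⟨ objMin≤maxVal π₁ ⟩
        maxVal f π₁                          ≤⟨ α-approx ⟩
        α * maxVal f π                       ≤⟨ *-monoʳ-≤-nonneg 0≤α (maxVal≤[m/E]*objMin π) ⟩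
        α * ((m / E) * objMin f lam π)       ≡⟨ solve 4 (λ a m e o → a :* ((m :* e) :* o) := ((m :* a) :* e) :* o) refl α m (E ⁻¹) (objMin f lam π) ⟩
        ((m * α) / E) * objMin f lam π       ∎
        where open ≤-Reasoning

      βE-approx : worst ≤ (β * E) * objMin f lam π
      βE-approx = begin
        worst                                ≤⟨ x⊓y≤y _ _ ⟩
        objMin f lam π₂                      ≤⟨ objMin≤avgVal*E π₂ ⟩
        avgVal f π₂ * E                      ≤⟨ *-monoˡ-≤-nonneg E-nonneg β-approx ⟩
        β * avgVal f π * E                   ≡⟨ solve 3 (λ b a e → b :* a :* e := (b :* e) :* a) refl β (avgVal f π) E ⟩
        (β * E) * avgVal f π                 ≤⟨ *-monoʳ-≤-nonneg (*-nonneg 0≤β E-nonneg) (avgVal≤objMin π) ⟩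
        (β * E) * objMin f lam π             ∎
        where open ≤-Reasoning

      combSlbSmp-approx : objMin f lam (combSlbSmp f lam π₁ π₂) ≤ min ((m * α) / E) (β * E) * objMin f lam π
      combSlbSmp-approx = ≤-respˡ-≡ (sym (combSlbSmp-objMin π₁ π₂))
        (min-preserves (λ ρ → worst ≤ ρ * objMin f lam π) mα/E-approx βE-approx)

    module Homogeneous (hom : ∀ i j → f i ≡ f j) (f₀-normalized : Normalized (f zero))
                       (f₀-mono : MonotoneNonDecreasing (f zero)) (f₀-submodular : Submodular (f zero)) where

      f⊤ : Carrier
      f⊤ = f zero ⊤

      value≤f⊤ : ∀ π i → value π i ≤ f⊤
      value≤f⊤ π i = ≤-respˡ-≡ (cong (λ g → g (block π i)) (hom zero i)) (f₀-mono (block π i) ⊤ ⊆⊤)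

      f⊤≤sumVal : ∀ π → f⊤ ≤ sumVal π
      f⊤≤sumVal π = ≤-respʳ-≡ (sumOver-cong (λ i → cong (λ g → g (block π i)) (hom zero i)))
                              (⊤-≤-sumOver-blocks f₀-normalized f₀-mono f₀-submodular π)

      avgVal≤f⊤ : ∀ π → avgVal f π ≤ f⊤
      avgVal≤f⊤ π = *μ-≤ (sumOver-≤ (value≤f⊤ π))

      min[α,1/m]-approx : ∀ {α} π₁ π → α * minVal f π ≤ minVal f π₁ → min α (1# / m) * objMax f lam π ≤ objMax f lam π₁
      min[α,1/m]-approx {α} π₁ π α-approx = begin
        c * objMax f lam π                                 ≡⟨ cong (c *_) (objMax≡ π) ⟩
        c * (lamᶜ * minVal f π + lam * avgVal f π)         ≡⟨ solve 5 (λ c d x l y → c :* (d :* x :+ l :* y) := d :* (c :* x) :+ l :* (c :* y)) refl c lamᶜ (minVal f π) lam (avgVal f π) ⟩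
        lamᶜ * (c * minVal f π) + lam * (c * avgVal f π)   ≤⟨ +-mono-≤ (*-monoʳ-≤-nonneg lamᶜ-nonneg c*minVal≤) (*-monoʳ-≤-nonneg 0≤lam c*avgVal≤) ⟩
        lamᶜ * minVal f π₁ + lam * avgVal f π₁             ≡⟨ sym (objMax≡ π₁) ⟩
        objMax f lam π₁                                    ∎
        where
        open ≤-Reasoning
        c : Carrier
        c = min α (1# / m)
        c*minVal≤ : c * minVal f π ≤ minVal f π₁
        c*minVal≤ = ≤-trans (*-monoˡ-≤-nonneg (minVal-nonneg π) (x⊓y≤x α (1# / m))) α-approx
        c*avgVal≤ : c * avgVal f π ≤ avgVal f π₁
        c*avgVal≤ = begin
          c * avgVal f π       ≤⟨ *-monoˡ-≤-nonneg (≤-trans (minVal-nonneg π) (minVal≤avgVal π)) (x⊓y≤y α (1# / m)) ⟩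
          (1# / m) * avgVal f π ≤⟨ *-monoʳ-≤-nonneg (*-nonneg 0≤1 μ-nonneg) (avgVal≤f⊤ π) ⟩
          (1# / m) * f⊤         ≡⟨ trans (cong (_* f⊤) (*-identityˡ μ)) (*-comm μ f⊤) ⟩
          f⊤ * μ                ≤⟨ *-monoˡ-≤-nonneg μ-nonneg (f⊤≤sumVal π₁) ⟩
          avgVal f π₁           ∎

      m-approx : ∀ π₁ π → objMin f lam π₁ ≤ m * objMin f lam π
      m-approx π₁ π = begin
        objMin f lam π₁       ≤⟨ objMin≤maxVal π₁ ⟩
        maxVal f π₁           ≤⟨ maxOver-lub (value≤f⊤ π₁) ⟩
        f⊤                    ≤⟨ f⊤≤sumVal π ⟩
        sumVal π              ≡⟨ trans (sumVal≡avgVal*m π) (*-comm (avgVal f π) m) ⟩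
        m * avgVal f π        ≤⟨ *-monoʳ-≤-nonneg m-nonneg (avgVal≤objMin π) ⟩
        m * objMin f lam π    ∎
        where open ≤-Reasoning

      combSfaSwp-approx-homogeneous : ∀ {α β} → 0# < α → 0# ≤ β → ∀ π₁ π₂ π →
        α * minVal f π ≤ minVal f π₁ → β * avgVal f π ≤ avgVal f π₂ →
        max (min α (1# / m)) (max ((β * α) / (lamᶜ * β + α)) (lam * β)) * objMax f lam π ≤ objMax f lam (combSfaSwp f lam π₁ π₂)
      combSfaSwp-approx-homogeneous 0<α 0≤β π₁ π₂ π α-approx β-approx =
        max-preserves (λ ρ → ρ * objMax f lam π ≤ objMax f lam (combSfaSwp f lam π₁ π₂))
          (≤-trans (min[α,1/m]-approx π₁ π α-approx) (≤-respʳ-≡ (sym (combSfaSwp-objMax π₁ π₂)) (x≤y⊔x _ _)))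
          (combSfaSwp-approx 0<α 0≤β π₁ π₂ π α-approx β-approx)

      combSlbSmp-approx-homogeneous : ∀ {α β} → 0# ≤ α → 0# ≤ β → ∀ π₁ π₂ π →
        maxVal f π₁ ≤ α * maxVal f π → avgVal f π₂ ≤ β * avgVal f π →
        objMin f lam (combSlbSmp f lam π₁ π₂) ≤ min m (min ((m * α) / E) (β * E)) * objMin f lam π
      combSlbSmp-approx-homogeneous 0≤α 0≤β π₁ π₂ π α-approx β-approx =
        min-preserves (λ ρ → objMin f lam (combSlbSmp f lam π₁ π₂) ≤ ρ * objMin f lam π)
          (≤-trans (≤-respˡ-≡ (sym (combSlbSmp-objMin π₁ π₂)) (x⊓y≤x _ _)) (m-approx π₁ π))
          (combSlbSmp-approx 0≤α 0≤β π₁ π₂ π α-approx β-approx)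

theorem10 : (F : OrderedField) →
  let open OrderedField F
      open Notions F
  in ∀ (n k : ℕ) (lam : Carrier) → 0# < lam → lam < 1# →
     (f : Fin (suc k) → Subset n → Carrier) →
     (∀ i → Normalized (f i)) → (∀ i → MonotoneNonDecreasing (f i)) → (∀ i → Submodular (f i)) →
     -- (a) heterogeneous case
     (∀ (α β : Carrier) → 0# < α → α ≤ 1# → 0# < β → β ≤ 1# →
      ∀ (π₁ π₂ : Partition n (suc k)) →
      (∀ π → α * minVal f π ≤ minVal f π₁) →
      (∀ π → β * avgVal f π ≤ avgVal f π₂) →
      ∀ π → max ((β * α) / ((1# - lam) * β + α)) (lam * β) * objMax f lam π
            ≤ objMax f lam (combSfaSwp f lam π₁ π₂))
     ×
     -- (a) homogeneous case
     ((∀ i j → f i ≡ f j) →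
      ∀ (α β : Carrier) → 0# < α → α ≤ 1# → 0# < β → β ≤ 1# →
      ∀ (π₁ π₂ : Partition n (suc k)) →
      (∀ π → α * minVal f π ≤ minVal f π₁) →
      (∀ π → β * avgVal f π ≤ avgVal f π₂) →
      ∀ π → max (min α (1# / m# f)) (max ((β * α) / ((1# - lam) * β + α)) (lam * β)) * objMax f lam π
            ≤ objMax f lam (combSfaSwp f lam π₁ π₂))
     ×
     -- (b) heterogeneous case
     (∀ (α β : Carrier) → 1# ≤ α → 1# ≤ β →
      ∀ (π₁ π₂ : Partition n (suc k)) →
      (∀ π → maxVal f π₁ ≤ α * maxVal f π) →
      (∀ π → avgVal f π₂ ≤ β * avgVal f π) →
      ∀ π → objMin f lam (combSlbSmp f lam π₁ π₂)
            ≤ min ((m# f * α) / (m# f * (1# - lam) + lam)) (β * (m# f * (1# - lam) + lam)) * objMin f lam π)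
     ×
     -- (b) homogeneous case
     ((∀ i j → f i ≡ f j) →
      ∀ (α β : Carrier) → 1# ≤ α → 1# ≤ β →
      ∀ (π₁ π₂ : Partition n (suc k)) →
      (∀ π → maxVal f π₁ ≤ α * maxVal f π) →
      (∀ π → avgVal f π₂ ≤ β * avgVal f π) →
      ∀ π → objMin f lam (combSlbSmp f lam π₁ π₂)
            ≤ min (m# f) (min ((m# f * α) / (m# f * (1# - lam) + lam)) (β * (m# f * (1# - lam) + lam))) * objMin f lam π)
theorem10 F n k lam (0≤lam , _) (lam≤1 , _) f f-normalized f-mono f-submodular =
    (λ α β 0<α _ 0<β _ π₁ π₂ α-approx β-approx π →
       combSfaSwp-approx 0<α (proj₁ 0<β) π₁ π₂ π (α-approx π) (β-approx π))
  , (λ hom α β 0<α _ 0<β _ π₁ π₂ α-approx β-approx π →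
       Homogeneous.combSfaSwp-approx-homogeneous hom (f-normalized zero) (f-mono zero) (f-submodular zero)
         0<α (proj₁ 0<β) π₁ π₂ π (α-approx π) (β-approx π))
  , (λ α β 1≤α 1≤β π₁ π₂ α-approx β-approx π →
       combSlbSmp-approx (≤-trans 0≤1 1≤α) (≤-trans 0≤1 1≤β) π₁ π₂ π (α-approx π) (β-approx π))
  , (λ hom α β 1≤α 1≤β π₁ π₂ α-approx β-approx π →
       Homogeneous.combSlbSmp-approx-homogeneous hom (f-normalized zero) (f-mono zero) (f-submodular zero)
         (≤-trans 0≤1 1≤α) (≤-trans 0≤1 1≤β) π₁ π₂ π (α-approx π) (β-approx π))
  where
  open OrderedFieldProperties F
  open Objectives.Bounds F f (λ i → SubmodularProperties.nonneg F (f-normalized i) (f-mono i) (f-submodular i)) 0≤lam lam≤1
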